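{- Let $G$ be a finite simple graph. Then $$V(G)=\alpha_{core}(G)\sqcup \tau_{core}(G)\sqcup B_{\alpha\cap\tau}$$ (a disjoint union), and furthermore: (i) $N(\alpha_{core}(G))\subseteq \tau_{core}(G)$; (ii) the induced subgraph $G[\alpha_{core}(G)]$ has no edges; (iii) the induced subgraph $G[B_{\alpha\cap\tau}]$ is both a $\tau$-critical graph and a $B$-graph without isolated vertices.
   Context: $\alpha(G)$ denotes the maximum cardinality of a stable (independent) set of $G$, and $\tau(G)$ the minimum cardinality of a vertex cover of $G$. $\alpha_{core}(G)$ is the intersection of all stable sets of $G$ of cardinality $\alpha(G)$; $\tau_{core}(G)$ is the intersection of all vertex covers of $G$ of cardinality $\tau(G)$; and $B_{\alpha\cap\tau}=V(G)\setminus(\alpha_{core}(G)\cup\tau_{core}(G))$. For $U\subseteq V(G)$, $N(U)$ is the set of vertices adjacent to some vertex of $U$, and $G[U]$ is the induced subgraph on $U$. A graph is a $B$-graph if every vertex belongs to a stable set of maximum cardinality. A graph $H$ is $\tau$-critical if $\tau(H\setminus v)<\tau(H)$ for every vertex $v$ of $H$. -}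

module Defs where

open import Data.Nat using (ℕ; _≤_; _<_)
open import Data.Bool using (Bool; true; false)
open import Data.Fin using (Fin; _≟_)
open import Data.Fin.Subset using (Subset; _∈_; _∉_; ∣_∣)
open import Data.Product using (_×_; ∃; ∃-syntax; Σ-syntax)
open import Data.Sum using (_⊎_)
open import Data.Unit using (⊤)
open import Relation.Nullary using (¬_)
open import Relation.Binary.PropositionalEquality using (_≡_)

record Graph (n : ℕ) : Set where
  field
    adj    : Fin n → Fin n → Bool
    sym    : ∀ u v → adj u v ≡ adj v u
    irrefl : ∀ v → adj v v ≡ false

open Graph public

module _ {n : ℕ} (G : Graph n) where

  Edge : Fin n → Fin n → Set
  Edge u v = adj G u v ≡ true

  -- A vertex region S ⊆ V(G); notions "in G[S]" are taken relative to S.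
  Region : Set₁
  Region = Fin n → Set

  All : Region
  All _ = ⊤

  _−_ : Region → Fin n → Region
  (S − v) u = S u × ¬ (u ≡ v)

  Within : Region → Subset n → Set
  Within S A = ∀ v → v ∈ A → S v

  Stable : Region → Subset n → Set
  Stable S A = Within S A × (∀ u v → u ∈ A → v ∈ A → ¬ Edge u v)

  MaxStable : Region → Subset n → Set
  MaxStable S A = Stable S A × (∀ B → Stable S B → ∣ B ∣ ≤ ∣ A ∣)

  Cover : Region → Subset n → Set
  Cover S C = Within S C × (∀ u v → S u → S v → Edge u v → u ∈ C ⊎ v ∈ C)

  MinCover : Region → Subset n → Set
  MinCover S C = Cover S C × (∀ D → Cover S D → ∣ C ∣ ≤ ∣ D ∣)

  αcore : Region
  αcore v = ∀ A → MaxStable All A → v ∈ A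

  τcore : Region
  τcore v = ∀ C → MinCover All C → v ∈ C

  Bατ : Region
  Bατ v = ¬ αcore v × ¬ τcore v

  Nbhd : Region → Region
  Nbhd U v = ∃[ u ] (U u × Edge u v)

  EdgelessOn : Region → Set
  EdgelessOn S = ∀ u v → S u → S v → ¬ Edge u v

  TauCritical : Region → Set
  TauCritical S = ∀ v → S v →
    ∃[ C ] (MinCover (S − v) C × (∀ D → MinCover S D → ∣ C ∣ < ∣ D ∣))

  BGraph : Region → Set
  BGraph S = ∀ v → S v → ∃[ A ] (MaxStable S A × v ∈ A)

  NoIsolated : Region → Set
  NoIsolated S = ∀ v → S v → ∃[ u ] (S u × Edge v u)

  DisjointDecomposition : Set
  DisjointDecomposition =
    (∀ v → αcore v ⊎ τcore v ⊎ Bατ v)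
    × (∀ v → ¬ (αcore v × τcore v))
    × (∀ v → ¬ (αcore v × Bατ v))
    × (∀ v → ¬ (τcore v × Bατ v))

-- Complementation A ↦ V(H) ∖ A exchanges the maximum stable sets and the
-- minimum vertex covers of any graph H, so τ_core(G) consists of the vertices
-- lying in no maximum stable set of G; (i) and (ii) follow at once.
-- For (iii) the key fact is that S ∩ B_{α∩τ} is a maximum stable set of
-- G[B_{α∩τ}] whenever S is a maximum stable set of G: by (i), a stable set E
-- of G[B_{α∩τ}] together with α_core(G) is stable in G, and S ⊆ B_{α∩τ} ∪ α_core(G),
-- so |E| + |α_core| ≤ |S| ≤ |S ∩ B_{α∩τ}| + |α_core|.  This yields the B-graph
-- property; a vertex v of B_{α∩τ} avoided by S lies in the minimum cover
-- B_{α∩τ} ∖ S of G[B_{α∩τ}], and deleting it from that cover shows τ drops;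
-- and S, being maximum, dominates v through a neighbour which must lie in
-- B_{α∩τ}, since neighbours of α_core(G) are in τ_core(G).
module Submission where

open import Defs hiding (sym)
open import Data.Bool using (true) renaming (_≟_ to _≟ᵇ_)
open import Data.Bool.Properties using (T-≡)
open import Data.Empty using (⊥-elim)
open import Data.Fin using (Fin; _≟_)
open import Data.Fin.Properties using (all?; any?)
open import Data.Fin.Subset
  using (Subset; inside; outside; _∈_; _∉_; _⊆_; ∣_∣; _∩_; _∪_; _─_; _-_; ⁅_⁆; Empty)
  renaming (⊥ to ∅)
open import Data.Fin.Subset.Properties
  using (_∈?_; anySubset?; ∉⊥; ∣p∣≤n; Empty-unique; ∣⊥∣≡0; ∣⁅x⁆∣≡1; x∈⁅y⁆⇒x≡y; x∉⁅y⁆⇒x≢y;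
         p⊆q⇒∣p∣≤∣q∣; ∣p∩q∣≤∣q∣; x∈p∩q⁺; x∈p∩q⁻; x∈p∪q⁺; x∈p∪q⁻;
         p─q⊆p; x∈p∧x∉q⇒x∈p─q; x∈p∧x≢y⇒x∈p-y; x∈p⇒∣p-x∣<∣p∣)
open import Data.Nat using (ℕ; zero; suc; _+_; _≤_; _<_; _≤?_; _<?_)
open import Data.Nat.Properties
  using (+-suc; +-comm; +-identityʳ; ≤-trans; ≤-reflexive; ≤-antisym; <-≤-trans;
         <-irrefl; ≮⇒≥; n<1+n; m≤m+n; m≤n+m; +-monoˡ-≤; +-monoʳ-≤; +-cancelʳ-≤; module ≤-Reasoning)
open import Data.Product using (_×_; _,_; proj₁; proj₂; ∃; ∃-syntax)
open import Data.Sum using (_⊎_; inj₁; inj₂; [_,_]′)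
import Data.Sum as Sum
open import Data.Unit using (tt)
open import Data.Vec using (_∷_; []; tabulate; here; there)
open import Data.Vec.Properties using ([]=⇒lookup; lookup⇒[]=; lookup∘tabulate)
open import Function using (_∘_; id)
open import Function.Bundles using (Equivalence)
open import Level using (Level)
open import Relation.Nullary using (¬_; Dec; yes; no; isYes)
open import Relation.Nullary.Decidable
  using (_×-dec_; _⊎-dec_; _→-dec_; ¬?; toWitness; fromWitness; decidable-stable)
open import Relation.Unary using (Pred; Decidable)
open import Relation.Binary.PropositionalEquality
  using (_≡_; refl; sym; trans; cong; subst; subst₂; module ≡-Reasoning)

private
  variable
    ℓ ℓ′ : Level
    n : ℕ

x∈p─q⇒x∉q : ∀ {p q : Subset n} {x} → x ∈ p ─ q → x ∉ q
x∈p─q⇒x∉q {p = _ ∷ _} {inside  ∷ _} ()         here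
x∈p─q⇒x∉q {p = _ ∷ _} {_ ∷ _}       (there x∈) (there x∈q) = x∈p─q⇒x∉q x∈ x∈q

∣p─q∣+∣p∩q∣≡∣p∣ : ∀ (p q : Subset n) → ∣ p ─ q ∣ + ∣ p ∩ q ∣ ≡ ∣ p ∣
∣p─q∣+∣p∩q∣≡∣p∣ []            []            = refl
∣p─q∣+∣p∩q∣≡∣p∣ (inside  ∷ p) (inside  ∷ q) = trans (+-suc _ _) (cong suc (∣p─q∣+∣p∩q∣≡∣p∣ p q))
∣p─q∣+∣p∩q∣≡∣p∣ (inside  ∷ p) (outside ∷ q) = cong suc (∣p─q∣+∣p∩q∣≡∣p∣ p q)
∣p─q∣+∣p∩q∣≡∣p∣ (outside ∷ p) (inside  ∷ q) = ∣p─q∣+∣p∩q∣≡∣p∣ p q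
∣p─q∣+∣p∩q∣≡∣p∣ (outside ∷ p) (outside ∷ q) = ∣p─q∣+∣p∩q∣≡∣p∣ p q

∣p∪q∣+∣p∩q∣≡∣p∣+∣q∣ : ∀ (p q : Subset n) → ∣ p ∪ q ∣ + ∣ p ∩ q ∣ ≡ ∣ p ∣ + ∣ q ∣
∣p∪q∣+∣p∩q∣≡∣p∣+∣q∣ []            []            = refl
∣p∪q∣+∣p∩q∣≡∣p∣+∣q∣ (inside  ∷ p) (inside  ∷ q) =
  cong suc (trans (+-suc _ _) (trans (cong suc (∣p∪q∣+∣p∩q∣≡∣p∣+∣q∣ p q)) (sym (+-suc _ _))))
∣p∪q∣+∣p∩q∣≡∣p∣+∣q∣ (inside  ∷ p) (outside ∷ q) = cong suc (∣p∪q∣+∣p∩q∣≡∣p∣+∣q∣ p q)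
∣p∪q∣+∣p∩q∣≡∣p∣+∣q∣ (outside ∷ p) (inside  ∷ q) =
  trans (cong suc (∣p∪q∣+∣p∩q∣≡∣p∣+∣q∣ p q)) (sym (+-suc _ _))
∣p∪q∣+∣p∩q∣≡∣p∣+∣q∣ (outside ∷ p) (outside ∷ q) = ∣p∪q∣+∣p∩q∣≡∣p∣+∣q∣ p q

q⊆p⇒∣p─q∣+∣q∣≡∣p∣ : ∀ {p q : Subset n} → q ⊆ p → ∣ p ─ q ∣ + ∣ q ∣ ≡ ∣ p ∣
q⊆p⇒∣p─q∣+∣q∣≡∣p∣ {p = p} {q} q⊆p =
  trans (cong (∣ p ─ q ∣ +_) (sym ∣p∩q∣≡∣q∣)) (∣p─q∣+∣p∩q∣≡∣p∣ p q)
  where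
  ∣p∩q∣≡∣q∣ : ∣ p ∩ q ∣ ≡ ∣ q ∣
  ∣p∩q∣≡∣q∣ = ≤-antisym (∣p∩q∣≤∣q∣ p q) (p⊆q⇒∣p∣≤∣q∣ (λ x∈q → x∈p∩q⁺ (q⊆p x∈q , x∈q)))

∣p∪q∣≤∣p∣+∣q∣ : ∀ (p q : Subset n) → ∣ p ∪ q ∣ ≤ ∣ p ∣ + ∣ q ∣
∣p∪q∣≤∣p∣+∣q∣ p q = subst (∣ p ∪ q ∣ ≤_) (∣p∪q∣+∣p∩q∣≡∣p∣+∣q∣ p q) (m≤m+n _ _)

Empty[p∩q]⇒∣p∪q∣≡∣p∣+∣q∣ : ∀ {p q : Subset n} → Empty (p ∩ q) → ∣ p ∪ q ∣ ≡ ∣ p ∣ + ∣ q ∣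
Empty[p∩q]⇒∣p∪q∣≡∣p∣+∣q∣ {n} {p} {q} disjoint = begin
  ∣ p ∪ q ∣              ≡⟨ sym (+-identityʳ _) ⟩
  ∣ p ∪ q ∣ + 0          ≡⟨ cong (∣ p ∪ q ∣ +_) (sym ∣p∩q∣≡0) ⟩
  ∣ p ∪ q ∣ + ∣ p ∩ q ∣  ≡⟨ ∣p∪q∣+∣p∩q∣≡∣p∣+∣q∣ p q ⟩
  ∣ p ∣ + ∣ q ∣          ∎
  where
  open ≡-Reasoning
  ∣p∩q∣≡0 : ∣ p ∩ q ∣ ≡ 0
  ∣p∩q∣≡0 = trans (cong ∣_∣ (Empty-unique disjoint)) (∣⊥∣≡0 n)

module _ {P : Pred (Fin n) ℓ} (P? : Decidable P) where

  toSubset : Subset n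
  toSubset = tabulate (isYes ∘ P?)

  ∈-toSubset⁺ : ∀ {x} → P x → x ∈ toSubset
  ∈-toSubset⁺ {x} px =
    lookup⇒[]= x toSubset (trans (lookup∘tabulate _ x) (Equivalence.to T-≡ (fromWitness px)))

  ∈-toSubset⁻ : ∀ {x} → x ∈ toSubset → P x
  ∈-toSubset⁻ {x} x∈ =
    toWitness (Equivalence.from T-≡ (trans (sym (lookup∘tabulate _ x)) ([]=⇒lookup x∈)))

module _ {P : Pred (Subset n) ℓ} {Q : Pred (Subset n) ℓ′} (P? : Decidable P) (Q? : Decidable Q) where

  allSubsets⊎counterexample : (∀ A → P A → Q A) ⊎ ∃[ A ] (P A × ¬ Q A)
  allSubsets⊎counterexample with anySubset? (λ A → P? A ×-dec ¬? (Q? A))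
  ... | yes counterexample = inj₂ counterexample
  ... | no ∄counterexample =
    inj₁ λ A pA → decidable-stable (Q? A) (λ ¬qA → ∄counterexample (A , pA , ¬qA))

  allSubsets? : Dec (∀ A → P A → Q A)
  allSubsets? = [ yes , (λ (A , pA , ¬qA) → no λ ∀PQ → ¬qA (∀PQ A pA)) ]′ allSubsets⊎counterexample

module _ {P : Pred (Subset n) ℓ} (P? : Decidable P) where

  maximum : ∀ A → P A → ∃[ M ] (P M × ∀ B → P B → ∣ B ∣ ≤ ∣ M ∣)
  maximum A pA = climb n A pA (m≤n+m n ∣ A ∣)
    where
    climb : ∀ k A → P A → n ≤ ∣ A ∣ + k → ∃[ M ] (P M × ∀ B → P B → ∣ B ∣ ≤ ∣ M ∣)
    climb k A pA n≤ with anySubset? (λ B → P? B ×-dec (∣ A ∣ <? ∣ B ∣))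
    ... | no ∄larger = A , pA , λ B pB → ≮⇒≥ (λ A<B → ∄larger (B , pB , A<B))
    climb zero A pA n≤ | yes (B , _ , A<B) =
      ⊥-elim (<-irrefl refl
        (<-≤-trans A<B (≤-trans (∣p∣≤n B) (≤-trans n≤ (≤-reflexive (+-identityʳ _))))))
    climb (suc k) A pA n≤ | yes (B , pB , A<B) =
      climb k B pB (≤-trans n≤ (≤-trans (≤-reflexive (+-suc ∣ A ∣ k)) (+-monoˡ-≤ k A<B)))

module _ (G : Graph n) where

  Edge? : ∀ u v → Dec (Edge G u v)
  Edge? u v = adj G u v ≟ᵇ true

  Edge-sym : ∀ {u v} → Edge G u v → Edge G v u
  Edge-sym {u} {v} e = trans (Graph.sym G v u) e

  Edge-irrefl : ∀ v → ¬ Edge G v v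
  Edge-irrefl v e with trans (sym e) (irrefl G v)
  ... | ()

  Stable-⁅⁆ : ∀ {R : Region G} {v} → R v → Stable G R ⁅ v ⁆
  Stable-⁅⁆ {R} {v} Rv =
    (λ u u∈ → subst R (sym (x∈⁅y⁆⇒x≡y v u∈)) Rv) ,
    (λ u w u∈ w∈ → subst₂ (λ a b → ¬ Edge G a b)
                          (sym (x∈⁅y⁆⇒x≡y v u∈)) (sym (x∈⁅y⁆⇒x≡y v w∈)) (Edge-irrefl v))

  Stable-∪ : ∀ {R : Region G} {A B} → Stable G R A → Stable G R B →
             (∀ u v → u ∈ A → v ∈ B → ¬ Edge G u v) → Stable G R (A ∪ B)
  Stable-∪ {A = A} {B} (withinA , independentA) (withinB , independentB) noCrossEdge =
    (λ v v∈ → [ withinA v , withinB v ]′ (x∈p∪q⁻ A B v∈)) ,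
    (λ u v u∈ v∈ → independent (x∈p∪q⁻ A B u∈) (x∈p∪q⁻ A B v∈))
    where
    independent : ∀ {u v} → u ∈ A ⊎ u ∈ B → v ∈ A ⊎ v ∈ B → ¬ Edge G u v
    independent {u} {v} (inj₁ u∈A) (inj₁ v∈A) = independentA u v u∈A v∈A
    independent {u} {v} (inj₁ u∈A) (inj₂ v∈B) = noCrossEdge u v u∈A v∈B
    independent {u} {v} (inj₂ u∈B) (inj₁ v∈A) = noCrossEdge v u v∈A u∈B ∘ Edge-sym
    independent {u} {v} (inj₂ u∈B) (inj₂ v∈B) = independentB u v u∈B v∈B

  module _ {R : Region G} (R? : Decidable R) where

    Within? : Decidable (Within G R)
    Within? A = all? (λ v → v ∈? A →-dec R? v)

    Stable? : Decidable (Stable G R)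
    Stable? A = Within? A ×-dec all? λ u → all? λ v → u ∈? A →-dec (v ∈? A →-dec ¬? (Edge? u v))

    Cover? : Decidable (Cover G R)
    Cover? C = Within? C ×-dec
      all? λ u → all? λ v → R? u →-dec (R? v →-dec (Edge? u v →-dec (u ∈? C ⊎-dec v ∈? C)))

    MaxStable? : Decidable (MaxStable G R)
    MaxStable? A = Stable? A ×-dec allSubsets? Stable? (λ B → ∣ B ∣ ≤? ∣ A ∣)

    MinCover? : Decidable (MinCover G R)
    MinCover? C = Cover? C ×-dec allSubsets? Cover? (λ D → ∣ C ∣ ≤? ∣ D ∣)

    vertices : Subset n
    vertices = toSubset R?

    Within⇒⊆vertices : ∀ {A} → Within G R A → A ⊆ vertices
    Within⇒⊆vertices within x∈A = ∈-toSubset⁺ R? (within _ x∈A)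

    Within[vertices─] : ∀ A → Within G R (vertices ─ A)
    Within[vertices─] A x x∈ = ∈-toSubset⁻ R? (p─q⊆p vertices A x∈)

    Stable⇒Cover[vertices─] : ∀ {A} → Stable G R A → Cover G R (vertices ─ A)
    Stable⇒Cover[vertices─] {A} (_ , independent) = Within[vertices─] A , covers
      where
      covers : ∀ u v → R u → R v → Edge G u v → u ∈ vertices ─ A ⊎ v ∈ vertices ─ A
      covers u v Ru Rv e with u ∈? A | v ∈? A
      ... | no u∉A  | _       = inj₁ (x∈p∧x∉q⇒x∈p─q (∈-toSubset⁺ R? Ru) u∉A)
      ... | yes _   | no v∉A  = inj₂ (x∈p∧x∉q⇒x∈p─q (∈-toSubset⁺ R? Rv) v∉A)
      ... | yes u∈A | yes v∈A = ⊥-elim (independent u v u∈A v∈A e)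

    Cover⇒Stable[vertices─] : ∀ {C} → Cover G R C → Stable G R (vertices ─ C)
    Cover⇒Stable[vertices─] {C} (_ , covers) = Within[vertices─] C , λ u v u∈ v∈ e →
      [ x∈p─q⇒x∉q u∈ , x∈p─q⇒x∉q v∈ ]′
        (covers u v (Within[vertices─] C u u∈) (Within[vertices─] C v v∈) e)

    MaxStable⇒MinCover[vertices─] : ∀ {A} → MaxStable G R A → MinCover G R (vertices ─ A)
    MaxStable⇒MinCover[vertices─] {A} (stable , maximal) =
      Stable⇒Cover[vertices─] stable , λ D cover → +-cancelʳ-≤ ∣ A ∣ _ _ (begin
        ∣ vertices ─ A ∣ + ∣ A ∣  ≡⟨ q⊆p⇒∣p─q∣+∣q∣≡∣p∣ (Within⇒⊆vertices (proj₁ stable)) ⟩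
        ∣ vertices ∣              ≡⟨ sym (q⊆p⇒∣p─q∣+∣q∣≡∣p∣ (Within⇒⊆vertices (proj₁ cover))) ⟩
        ∣ vertices ─ D ∣ + ∣ D ∣  ≤⟨ +-monoˡ-≤ ∣ D ∣ (maximal _ (Cover⇒Stable[vertices─] cover)) ⟩
        ∣ A ∣ + ∣ D ∣             ≡⟨ +-comm ∣ A ∣ ∣ D ∣ ⟩
        ∣ D ∣ + ∣ A ∣             ∎)
      where open ≤-Reasoning

    MinCover⇒MaxStable[vertices─] : ∀ {C} → MinCover G R C → MaxStable G R (vertices ─ C)
    MinCover⇒MaxStable[vertices─] {C} (cover , minimal) =
      Cover⇒Stable[vertices─] cover , λ B stable → +-cancelʳ-≤ ∣ C ∣ _ _ (begin
        ∣ B ∣ + ∣ C ∣             ≤⟨ +-monoʳ-≤ ∣ B ∣ (minimal _ (Stable⇒Cover[vertices─] stable)) ⟩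
        ∣ B ∣ + ∣ vertices ─ B ∣  ≡⟨ +-comm ∣ B ∣ _ ⟩
        ∣ vertices ─ B ∣ + ∣ B ∣  ≡⟨ q⊆p⇒∣p─q∣+∣q∣≡∣p∣ (Within⇒⊆vertices (proj₁ stable)) ⟩
        ∣ vertices ∣              ≡⟨ sym (q⊆p⇒∣p─q∣+∣q∣≡∣p∣ (Within⇒⊆vertices (proj₁ cover))) ⟩
        ∣ vertices ─ C ∣ + ∣ C ∣  ∎)
      where open ≤-Reasoning

    maxStable : ∃ (MaxStable G R)
    maxStable = maximum Stable? ∅ ((λ _ v∈∅ → ⊥-elim (∉⊥ v∈∅)) , (λ _ _ u∈∅ → ⊥-elim (∉⊥ u∈∅)))

    minCover : ∃ (MinCover G R)
    minCover = vertices ─ proj₁ maxStable , MaxStable⇒MinCover[vertices─] (proj₂ maxStable)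

    maxStable-dominating : ∀ {S v} → MaxStable G R S → R v → v ∉ S → ∃[ u ] (u ∈ S × Edge G v u)
    maxStable-dominating {S} {v} (stable , maximal) Rv v∉S with any? (λ u → u ∈? S ×-dec Edge? v u)
    ... | yes neighbour = neighbour
    ... | no ∄neighbour = ⊥-elim (<-irrefl refl (begin-strict
          ∣ S ∣              <⟨ n<1+n ∣ S ∣ ⟩
          1 + ∣ S ∣          ≡⟨ cong (_+ ∣ S ∣) (sym (∣⁅x⁆∣≡1 v)) ⟩
          ∣ ⁅ v ⁆ ∣ + ∣ S ∣  ≡⟨ sym (Empty[p∩q]⇒∣p∪q∣≡∣p∣+∣q∣ disjoint) ⟩
          ∣ ⁅ v ⁆ ∪ S ∣      ≤⟨ maximal _ (Stable-∪ (Stable-⁅⁆ Rv) stable noCrossEdge) ⟩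
          ∣ S ∣              ∎))
      where
      open ≤-Reasoning
      noCrossEdge : ∀ u w → u ∈ ⁅ v ⁆ → w ∈ S → ¬ Edge G u w
      noCrossEdge u w u∈ w∈S e rewrite x∈⁅y⁆⇒x≡y v u∈ = ∄neighbour (w , w∈S , e)
      disjoint : Empty (⁅ v ⁆ ∩ S)
      disjoint (u , u∈) = let (u∈⁅v⁆ , u∈S) = x∈p∩q⁻ ⁅ v ⁆ S u∈ in
        v∉S (subst (_∈ S) (x∈⁅y⁆⇒x≡y v u∈⁅v⁆) u∈S)

  minCover∋v⇒τ-drops : ∀ {R : Region G} (R? : Decidable R) {v D} → MinCover G R D → v ∈ D →
    ∃[ C ] (MinCover G (_−_ G R v) C × ∀ D′ → MinCover G R D′ → ∣ C ∣ < ∣ D′ ∣)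
  minCover∋v⇒τ-drops {R} R? {v} {D} (coverD , minimalD) v∈D =
    C , minimumC , λ D′ minimumD′ → begin-strict
      ∣ C ∣      ≤⟨ proj₂ minimumC (D - v) coverD-v ⟩
      ∣ D - v ∣  <⟨ x∈p⇒∣p-x∣<∣p∣ v∈D ⟩
      ∣ D ∣      ≤⟨ minimalD D′ (proj₁ minimumD′) ⟩
      ∣ D′ ∣     ∎
    where
    open ≤-Reasoning
    R-v? : Decidable (_−_ G R v)
    R-v? x = R? x ×-dec ¬? (x ≟ v)
    C : Subset n
    C = proj₁ (minCover R-v?)
    minimumC : MinCover G (_−_ G R v) C
    minimumC = proj₂ (minCover R-v?)
    coverD-v : Cover G (_−_ G R v) (D - v)
    coverD-v =
      (λ x x∈ → proj₁ coverD x (p─q⊆p D ⁅ v ⁆ x∈) , x∉⁅y⁆⇒x≢y (x∈p─q⇒x∉q x∈)) ,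
      (λ x y (Rx , x≢v) (Ry , y≢v) e →
        Sum.map (λ x∈D → x∈p∧x≢y⇒x∈p-y x∈D x≢v) (λ y∈D → x∈p∧x≢y⇒x∈p-y y∈D y≢v)
                (proj₂ coverD x y Rx Ry e))

module Cores (G : Graph n) where

  V? : Decidable (All G)
  V? _ = yes tt

  maxStable∌τcore : ∀ {S v} → MaxStable G (All G) S → v ∈ S → ¬ τcore G v
  maxStable∌τcore maxS v∈S τv = x∈p─q⇒x∉q (τv _ (MaxStable⇒MinCover[vertices─] G V? maxS)) v∈S

  αcore⊎avoidingMaxStable : ∀ v → αcore G v ⊎ ∃[ S ] (MaxStable G (All G) S × v ∉ S)
  αcore⊎avoidingMaxStable v = allSubsets⊎counterexample (MaxStable? G V?) (v ∈?_)

  τcore⊎containingMaxStable : ∀ v → τcore G v ⊎ ∃[ S ] (MaxStable G (All G) S × v ∈ S)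
  τcore⊎containingMaxStable v = Sum.map₂ complement (allSubsets⊎counterexample (MinCover? G V?) (v ∈?_))
    where
    complement : ∃[ C ] (MinCover G (All G) C × v ∉ C) → ∃[ S ] (MaxStable G (All G) S × v ∈ S)
    complement (C , minC , v∉C) =
      vertices G V? ─ C , MinCover⇒MaxStable[vertices─] G V? minC , x∈p∧x∉q⇒x∈p─q (∈-toSubset⁺ V? tt) v∉C

  avoidingMaxStable : ∀ {v} → ¬ αcore G v → ∃[ S ] (MaxStable G (All G) S × v ∉ S)
  avoidingMaxStable ¬αv = [ ⊥-elim ∘ ¬αv , id ]′ (αcore⊎avoidingMaxStable _)

  containingMaxStable : ∀ {v} → ¬ τcore G v → ∃[ S ] (MaxStable G (All G) S × v ∈ S)
  containingMaxStable ¬τv = [ ⊥-elim ∘ ¬τv , id ]′ (τcore⊎containingMaxStable _)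

  αcore? : Decidable (αcore G)
  αcore? v = [ yes , (λ (S , maxS , v∉S) → no λ αv → v∉S (αv S maxS)) ]′ (αcore⊎avoidingMaxStable v)

  τcore? : Decidable (τcore G)
  τcore? v = [ yes , (λ (S , maxS , v∈S) → no (maxStable∌τcore maxS v∈S)) ]′
               (τcore⊎containingMaxStable v)

  Bατ? : Decidable (Bατ G)
  Bατ? v = ¬? (αcore? v) ×-dec ¬? (τcore? v)

  maxStable⊆αcore∪Bατ : ∀ {S v} → MaxStable G (All G) S → v ∈ S → αcore G v ⊎ Bατ G v
  maxStable⊆αcore∪Bατ maxS v∈S with αcore⊎avoidingMaxStable _
  ... | inj₁ αv = inj₁ αv
  ... | inj₂ (S′ , maxS′ , v∉S′) = inj₂ ((λ αv → v∉S′ (αv S′ maxS′)) , maxStable∌τcore maxS v∈S)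

  disjointDecomposition : DisjointDecomposition G
  disjointDecomposition =
    decomposition ,
    (λ v (αv , τv) → let (M , maxM) = maxStable G V? in maxStable∌τcore maxM (αv M maxM) τv) ,
    (λ v (αv , ¬αv , _) → ¬αv αv) ,
    (λ v (τv , _ , ¬τv) → ¬τv τv)
    where
    decomposition : ∀ v → αcore G v ⊎ τcore G v ⊎ Bατ G v
    decomposition v with αcore? v | τcore? v
    ... | yes αv | _      = inj₁ αv
    ... | no ¬αv | yes τv = inj₂ (inj₁ τv)
    ... | no ¬αv | no ¬τv = inj₂ (inj₂ (¬αv , ¬τv))

  Nbhd[αcore]⊆τcore : ∀ v → Nbhd G (αcore G) v → τcore G v
  Nbhd[αcore]⊆τcore v (u , αu , e) =
    [ id , (λ (S , maxS , v∈S) → ⊥-elim (proj₂ (proj₁ maxS) u v (αu S maxS) v∈S e)) ]′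
      (τcore⊎containingMaxStable v)

  αcore-edgeless : EdgelessOn G (αcore G)
  αcore-edgeless u v αu αv =
    let (M , maxM) = maxStable G V? in proj₂ (proj₁ maxM) u v (αu M maxM) (αv M maxM)

  αcoreˢ Bατˢ : Subset n
  αcoreˢ = toSubset αcore?
  Bατˢ = vertices G Bατ?

  maxStable∩Bατ : ∀ {S} → MaxStable G (All G) S → MaxStable G (Bατ G) (S ∩ Bατˢ)
  maxStable∩Bατ {S} maxS@((_ , independentS) , maximalS) =
    ((λ x x∈ → ∈-toSubset⁻ Bατ? (proj₂ (x∈p∩q⁻ S Bατˢ x∈))) ,
     (λ u v u∈ v∈ → independentS u v (proj₁ (x∈p∩q⁻ S Bατˢ u∈)) (proj₁ (x∈p∩q⁻ S Bατˢ v∈)))) ,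
    bound
    where
    αcoreˢ-stable : Stable G (All G) αcoreˢ
    αcoreˢ-stable = (λ _ _ → tt) , λ u v u∈ v∈ →
      αcore-edgeless u v (∈-toSubset⁻ αcore? u∈) (∈-toSubset⁻ αcore? v∈)

    S⊆[S∩Bατ]∪αcore : S ⊆ S ∩ Bατˢ ∪ αcoreˢ
    S⊆[S∩Bατ]∪αcore x∈S =
      [ (λ αx → x∈p∪q⁺ (inj₂ (∈-toSubset⁺ αcore? αx))) ,
        (λ Bx → x∈p∪q⁺ (inj₁ (x∈p∩q⁺ (x∈S , ∈-toSubset⁺ Bατ? Bx)))) ]′
        (maxStable⊆αcore∪Bατ maxS x∈S)

    bound : ∀ E → Stable G (Bατ G) E → ∣ E ∣ ≤ ∣ S ∩ Bατˢ ∣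
    bound E (withinE , independentE) = +-cancelʳ-≤ ∣ αcoreˢ ∣ _ _ (begin
      ∣ E ∣ + ∣ αcoreˢ ∣             ≡⟨ sym (Empty[p∩q]⇒∣p∪q∣≡∣p∣+∣q∣ disjoint) ⟩
      ∣ E ∪ αcoreˢ ∣                 ≤⟨ maximalS _ E∪αcore-stable ⟩
      ∣ S ∣                          ≤⟨ p⊆q⇒∣p∣≤∣q∣ S⊆[S∩Bατ]∪αcore ⟩
      ∣ S ∩ Bατˢ ∪ αcoreˢ ∣          ≤⟨ ∣p∪q∣≤∣p∣+∣q∣ (S ∩ Bατˢ) αcoreˢ ⟩
      ∣ S ∩ Bατˢ ∣ + ∣ αcoreˢ ∣      ∎)
      where
      open ≤-Reasoning
      disjoint : Empty (E ∩ αcoreˢ)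
      disjoint (x , x∈) = let (x∈E , x∈αcore) = x∈p∩q⁻ E αcoreˢ x∈ in
        proj₁ (withinE x x∈E) (∈-toSubset⁻ αcore? x∈αcore)
      noCrossEdge : ∀ u v → u ∈ E → v ∈ αcoreˢ → ¬ Edge G u v
      noCrossEdge u v u∈E v∈αcore e =
        proj₂ (withinE u u∈E) (Nbhd[αcore]⊆τcore u (v , ∈-toSubset⁻ αcore? v∈αcore , Edge-sym G e))
      E∪αcore-stable : Stable G (All G) (E ∪ αcoreˢ)
      E∪αcore-stable = Stable-∪ G ((λ _ _ → tt) , independentE) αcoreˢ-stable noCrossEdge

  Bατ-BGraph : BGraph G (Bατ G)
  Bατ-BGraph v Bv@(_ , ¬τv) =
    let (S , maxS , v∈S) = containingMaxStable ¬τv in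
    S ∩ Bατˢ , maxStable∩Bατ maxS , x∈p∩q⁺ (v∈S , ∈-toSubset⁺ Bατ? Bv)

  Bατ-TauCritical : TauCritical G (Bατ G)
  Bατ-TauCritical v Bv@(¬αv , _) =
    let (S , maxS , v∉S) = avoidingMaxStable ¬αv in
    minCover∋v⇒τ-drops G Bατ? (MaxStable⇒MinCover[vertices─] G Bατ? (maxStable∩Bατ maxS))
      (x∈p∧x∉q⇒x∈p─q (∈-toSubset⁺ Bατ? Bv) (v∉S ∘ proj₁ ∘ x∈p∩q⁻ S Bατˢ))

  Bατ-NoIsolated : NoIsolated G (Bατ G)
  Bατ-NoIsolated v (¬αv , ¬τv) =
    let (S , maxS , v∉S) = avoidingMaxStable ¬αv
        (u , u∈S , e) = maxStable-dominating G V? maxS tt v∉S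
    in u , [ (λ αu → ⊥-elim (¬τv (Nbhd[αcore]⊆τcore v (u , αu , Edge-sym G e)))) , id ]′
             (maxStable⊆αcore∪Bατ maxS u∈S) , e

proposition2p3 : (n : ℕ) (G : Graph n) →
    DisjointDecomposition G
    × (∀ v → Nbhd G (αcore G) v → τcore G v)
    × EdgelessOn G (αcore G)
    × (TauCritical G (Bατ G) × BGraph G (Bατ G) × NoIsolated G (Bατ G))
proposition2p3 n G =
  disjointDecomposition , Nbhd[αcore]⊆τcore , αcore-edgeless ,
  Bατ-TauCritical , Bατ-BGraph , Bατ-NoIsolated
  where open Cores G
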